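{- Let $\mathbf{C}$ be a category with a stable system of monics $\mathcal{M}$ and a class of morphisms $\mathcal{E}$ such that $\mathbf{C}$ is $(\mathcal{E},\mathcal{M})$-structured, $\mathbf{C}$ has pullbacks, pushouts and final pullback complements along $\mathcal{M}$-morphisms, $\mathcal{M}$-morphisms are stable under pushout, and pushouts along $\mathcal{M}$-morphisms are stable under $\mathcal{M}$-pullbacks. Then the category $\mathsf{FPC}_v(\mathbf{C},\mathcal{M})$ is (auto-augmented, inert)-structured, i.e. the pair consisting of the class of auto-augmented FPC squares and the class of inert FPC squares is a factorization structure for morphisms in $\mathsf{FPC}_v(\mathbf{C},\mathcal{M})$.
   Context: A stable system of monics in $\mathbf{C}$ is a class $\mathcal{M}$ of monomorphisms containing all isomorphisms, closed under composition, and stable under pullback. For classes $E,M$ of morphisms of a category $\mathbf{D}$, $\mathbf{D}$ is $(E,M)$-structured if (i) $E$ and $M$ are closed under composition with isomorphisms, (ii) every morphism $f$ factors as $f=m\circ e$ with $e\in E$, $m\in M$, and (iii) for every commutative square $g\circ e=m\circ f$ with $e\in E$, $m\in M$ there is a unique $d$ with $f=d\circ e$ and $g=m\circ d$. $\mathbf{C}$ has pullbacks (resp. pushouts) along $\mathcal{M}$-morphisms if pullbacks of cospans with one leg in $\mathcal{M}$ (resp. pushouts of spans with one leg in $\mathcal{M}$) exist; $\mathcal{M}$-morphisms are stable under pushout if the pushout of an $\mathcal{M}$-morphism along any morphism is in $\mathcal{M}$; pushouts along $\mathcal{M}$-morphisms are stable under $\mathcal{M}$-pullbacks if for every commutative cube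 whose bottom face is a pushout of a span with one leg in $\mathcal{M}$, whose vertical faces are pullbacks and whose vertical morphisms are in $\mathcal{M}$, the top face is a pushout. Given composable $f:A\to B$, $m:B\to C$, a pair $(n:A\to F,g:F\to C)$ is a final pullback complement (FPC) of $(f,m)$ if $g\circ n=m\circ f$, this square is a pullback, and for every pullback square $d\circ y=m\circ z$ ($z:X\to B$, $y:X\to Y$, $d:Y\to C$) and every $x:X\to A$ with $f\circ x=z$ there is a unique $x':Y\to F$ with $g\circ x'=d$, $x'\circ y=n\circ x$; FPCs along $\mathcal{M}$-morphisms exist if an FPC of $(f,m)$ exists whenever $m\in\mathcal{M}$. $\mathsf{FPC}_v(\mathbf{C},\mathcal{M})$ has as objects the morphisms of $\mathbf{C}$ and as morphisms from $f:A\to B$ to $f':A'\to B'$ the pairs $(\alpha:A\to A',\beta:B\to B')$ with $\alpha,\beta\in\mathcal{M}$, $\beta\circ f=f'\circ\alpha$ and $(\alpha,f')$ an FPC of $(f,\beta)$ (an "FPC square"), composed by vertical pasting. Such an FPC square is auto-augmented if, taking a pushout $(p:A'\to P,q:B\to P)$ of the span $(\alpha,f)$, the induced morphism $u:P\to B'$ with $u\circ p=f'$ and $u\circ q=\beta$ lies in $\mathcal{E}$. It is inert if $\alpha$ (its vertical side at the domain end $A\to A'$) lies in $\mathcal{E}\cap\mathcal{M}$, i.e. is an isomorphism of $\mathbf{C}$. -}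

module Defs where

open import Level using (Level; _⊔_) renaming (suc to lsuc)
open import Data.Product using (Σ; _×_; _,_; proj₁; proj₂; Σ-syntax)
open import Relation.Binary using (Rel; IsEquivalence; Setoid)
import Relation.Binary.Reasoning.Setoid as SetoidR

record Category (o ℓ e : Level) : Set (lsuc (o ⊔ ℓ ⊔ e)) where
  infixr 9 _∘_
  infix 4 _≈_
  infix 4 _⇒_
  field
    Obj       : Set o
    _⇒_       : Obj → Obj → Set ℓ
    _≈_       : ∀ {A B} → Rel (A ⇒ B) e
    id        : ∀ {A} → A ⇒ A
    _∘_       : ∀ {A B C} → B ⇒ C → A ⇒ B → A ⇒ C
    equiv     : ∀ {A B} → IsEquivalence (_≈_ {A} {B})
    ∘-resp-≈  : ∀ {A B C} {f h : B ⇒ C} {g i : A ⇒ B} →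
                f ≈ h → g ≈ i → f ∘ g ≈ h ∘ i
    assoc     : ∀ {A B C D} {f : A ⇒ B} {g : B ⇒ C} {h : C ⇒ D} →
                (h ∘ g) ∘ f ≈ h ∘ (g ∘ f)
    identityˡ : ∀ {A B} {f : A ⇒ B} → id ∘ f ≈ f
    identityʳ : ∀ {A B} {f : A ⇒ B} → f ∘ id ≈ f

  hom-setoid : ∀ {A B} → Setoid ℓ e
  hom-setoid {A} {B} = record { Carrier = A ⇒ B ; _≈_ = _≈_ ; isEquivalence = equiv }

  module HomReasoning {A B : Obj} = SetoidR (hom-setoid {A} {B})

  ≈-refl : ∀ {A B} {f : A ⇒ B} → f ≈ f
  ≈-refl = IsEquivalence.refl equiv

  ≈-sym : ∀ {A B} {f g : A ⇒ B} → f ≈ g → g ≈ f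
  ≈-sym = IsEquivalence.sym equiv

  ≈-trans : ∀ {A B} {f g h : A ⇒ B} → f ≈ g → g ≈ h → f ≈ h
  ≈-trans = IsEquivalence.trans equiv

  ∘ˡ : ∀ {A B C} {f h : B ⇒ C} {g : A ⇒ B} → f ≈ h → f ∘ g ≈ h ∘ g
  ∘ˡ p = ∘-resp-≈ p ≈-refl

  ∘ʳ : ∀ {A B C} {f : B ⇒ C} {g i : A ⇒ B} → g ≈ i → f ∘ g ≈ f ∘ i
  ∘ʳ p = ∘-resp-≈ ≈-refl p

MorClass : ∀ {o ℓ e} → Category o ℓ e → (p : Level) → Set (o ⊔ ℓ ⊔ lsuc p)
MorClass C p = ∀ {A B} → A ⇒ B → Set p
  where open Category C

module Notions {o ℓ e} (C : Category o ℓ e) where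
  open Category C

  IsIso : ∀ {A B} → A ⇒ B → Set (ℓ ⊔ e)
  IsIso {A} {B} f = Σ[ g ∈ B ⇒ A ] (g ∘ f ≈ id × f ∘ g ≈ id)

  Mono : ∀ {A B} → A ⇒ B → Set (o ⊔ ℓ ⊔ e)
  Mono {A} f = ∀ {X} (g h : X ⇒ A) → f ∘ g ≈ f ∘ h → g ≈ h

  record IsPullback {P A B Z} (p₁ : P ⇒ A) (p₂ : P ⇒ B) (f : A ⇒ Z) (g : B ⇒ Z)
         : Set (o ⊔ ℓ ⊔ e) where
    field
      commute     : f ∘ p₁ ≈ g ∘ p₂
      universal   : ∀ {X} (h₁ : X ⇒ A) (h₂ : X ⇒ B) → f ∘ h₁ ≈ g ∘ h₂ → X ⇒ P
      p₁∘universal : ∀ {X} {h₁ : X ⇒ A} {h₂ : X ⇒ B} {eq : f ∘ h₁ ≈ g ∘ h₂} →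
                     p₁ ∘ universal h₁ h₂ eq ≈ h₁
      p₂∘universal : ∀ {X} {h₁ : X ⇒ A} {h₂ : X ⇒ B} {eq : f ∘ h₁ ≈ g ∘ h₂} →
                     p₂ ∘ universal h₁ h₂ eq ≈ h₂
      unique      : ∀ {X} {h₁ : X ⇒ A} {h₂ : X ⇒ B} (eq : f ∘ h₁ ≈ g ∘ h₂) (v : X ⇒ P) →
                    p₁ ∘ v ≈ h₁ → p₂ ∘ v ≈ h₂ → v ≈ universal h₁ h₂ eq

    unique-diagram : ∀ {X} {v w : X ⇒ P} → p₁ ∘ v ≈ p₁ ∘ w → p₂ ∘ v ≈ p₂ ∘ w → v ≈ w
    unique-diagram {v = v} {w} e₁ e₂ =
      ≈-trans (unique eq v e₁ e₂) (≈-sym (unique eq w ≈-refl ≈-refl))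
      where
      eq = ≈-trans (≈-sym assoc) (≈-trans (∘ˡ commute) assoc)

  record IsPushout {Z A B Q} (f : Z ⇒ A) (g : Z ⇒ B) (i₁ : A ⇒ Q) (i₂ : B ⇒ Q)
         : Set (o ⊔ ℓ ⊔ e) where
    field
      commute     : i₁ ∘ f ≈ i₂ ∘ g
      universal   : ∀ {X} (h₁ : A ⇒ X) (h₂ : B ⇒ X) → h₁ ∘ f ≈ h₂ ∘ g → Q ⇒ X
      universal∘i₁ : ∀ {X} {h₁ : A ⇒ X} {h₂ : B ⇒ X} {eq : h₁ ∘ f ≈ h₂ ∘ g} →
                     universal h₁ h₂ eq ∘ i₁ ≈ h₁
      universal∘i₂ : ∀ {X} {h₁ : A ⇒ X} {h₂ : B ⇒ X} {eq : h₁ ∘ f ≈ h₂ ∘ g} →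
                     universal h₁ h₂ eq ∘ i₂ ≈ h₂
      unique      : ∀ {X} {h₁ : A ⇒ X} {h₂ : B ⇒ X} (eq : h₁ ∘ f ≈ h₂ ∘ g) (v : Q ⇒ X) →
                    v ∘ i₁ ≈ h₁ → v ∘ i₂ ≈ h₂ → v ≈ universal h₁ h₂ eq

  record IsFPC {A B C' F} (f : A ⇒ B) (m : B ⇒ C') (n : A ⇒ F) (g : F ⇒ C')
         : Set (o ⊔ ℓ ⊔ e) where
    field
      pullback  : IsPullback n f g m
      universal : ∀ {X Y} {z : X ⇒ B} {y : X ⇒ Y} {d : Y ⇒ C'} →
                  IsPullback y z d m → (x : X ⇒ A) → f ∘ x ≈ z → Y ⇒ F
      g∘universal : ∀ {X Y} {z : X ⇒ B} {y : X ⇒ Y} {d : Y ⇒ C'}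
                    {pb : IsPullback y z d m} {x : X ⇒ A} {eq : f ∘ x ≈ z} →
                    g ∘ universal pb x eq ≈ d
      universal∘y : ∀ {X Y} {z : X ⇒ B} {y : X ⇒ Y} {d : Y ⇒ C'}
                    {pb : IsPullback y z d m} {x : X ⇒ A} {eq : f ∘ x ≈ z} →
                    universal pb x eq ∘ y ≈ n ∘ x
      unique    : ∀ {X Y} {z : X ⇒ B} {y : X ⇒ Y} {d : Y ⇒ C'}
                  (pb : IsPullback y z d m) (x : X ⇒ A) (eq : f ∘ x ≈ z) (v : Y ⇒ F) →
                  g ∘ v ≈ d → v ∘ y ≈ n ∘ x → v ≈ universal pb x eq

  record StableSystem {p} (M : MorClass C p) : Set (o ⊔ ℓ ⊔ e ⊔ p) where
    field
      iso∈      : ∀ {A B} {f : A ⇒ B} → IsIso f → M f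
      mono      : ∀ {A B} {f : A ⇒ B} → M f → Mono f
      comp      : ∀ {A B D} {f : A ⇒ B} {g : B ⇒ D} → M f → M g → M (g ∘ f)
      pb-stable : ∀ {P A B Z} {p₁ : P ⇒ A} {p₂ : P ⇒ B} {f : A ⇒ Z} {g : B ⇒ Z} →
                  IsPullback p₁ p₂ f g → M g → M p₁

  HasPullbacksAlong : ∀ {p} → MorClass C p → Set (o ⊔ ℓ ⊔ e ⊔ p)
  HasPullbacksAlong M = ∀ {A B Z} (f : A ⇒ Z) (m : B ⇒ Z) → M m →
    Σ[ P ∈ Obj ] Σ[ p₁ ∈ P ⇒ A ] Σ[ p₂ ∈ P ⇒ B ] IsPullback p₁ p₂ f m

  HasPushoutsAlong : ∀ {p} → MorClass C p → Set (o ⊔ ℓ ⊔ e ⊔ p)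
  HasPushoutsAlong M = ∀ {Z A B} (m : Z ⇒ A) (f : Z ⇒ B) → M m →
    Σ[ Q ∈ Obj ] Σ[ i₁ ∈ A ⇒ Q ] Σ[ i₂ ∈ B ⇒ Q ] IsPushout m f i₁ i₂

  HasFPCsAlong : ∀ {p} → MorClass C p → Set (o ⊔ ℓ ⊔ e ⊔ p)
  HasFPCsAlong M = ∀ {A B C'} (f : A ⇒ B) (m : B ⇒ C') → M m →
    Σ[ F ∈ Obj ] Σ[ n ∈ A ⇒ F ] Σ[ g ∈ F ⇒ C' ] IsFPC f m n g

  StableUnderPushout : ∀ {p} → MorClass C p → Set (o ⊔ ℓ ⊔ e ⊔ p)
  StableUnderPushout M = ∀ {Z A B Q} {f : Z ⇒ A} {g : Z ⇒ B} {i₁ : A ⇒ Q} {i₂ : B ⇒ Q} →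
    IsPushout f g i₁ i₂ → M f → M i₂

  PushoutsStableUnderMPullbacks : ∀ {p} → MorClass C p → Set (o ⊔ ℓ ⊔ e ⊔ p)
  PushoutsStableUnderMPullbacks M =
    ∀ {Z A B Q Z' A' B' Q'}
      {m : Z ⇒ A} {f : Z ⇒ B} {i₁ : A ⇒ Q} {i₂ : B ⇒ Q}
      {m' : Z' ⇒ A'} {f' : Z' ⇒ B'} {i₁' : A' ⇒ Q'} {i₂' : B' ⇒ Q'}
      {z : Z' ⇒ Z} {a : A' ⇒ A} {b : B' ⇒ B} {q : Q' ⇒ Q} →
    M m → IsPushout m f i₁ i₂ →
    M z → M a → M b → M q →
    i₁' ∘ m' ≈ i₂' ∘ f' →
    IsPullback m' z a m →
    IsPullback f' z b f →
    IsPullback i₁' a q i₁ →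
    IsPullback i₂' b q i₂ →
    IsPushout m' f' i₁' i₂'

  record EMStructured {p q} (E : MorClass C p) (M : MorClass C q)
         : Set (o ⊔ ℓ ⊔ e ⊔ p ⊔ q) where
    field
      E-isoˡ : ∀ {A B D} {f : A ⇒ B} {i : B ⇒ D} → IsIso i → E f → E (i ∘ f)
      E-isoʳ : ∀ {A B D} {i : A ⇒ B} {f : B ⇒ D} → IsIso i → E f → E (f ∘ i)
      M-isoˡ : ∀ {A B D} {f : A ⇒ B} {i : B ⇒ D} → IsIso i → M f → M (i ∘ f)
      M-isoʳ : ∀ {A B D} {i : A ⇒ B} {f : B ⇒ D} → IsIso i → M f → M (f ∘ i)
      factor : ∀ {A B} (f : A ⇒ B) →
               Σ[ X ∈ Obj ] Σ[ e ∈ A ⇒ X ] Σ[ m ∈ X ⇒ B ] (E e × M m × m ∘ e ≈ f)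
      diagonal : ∀ {A B D F} {e : A ⇒ B} {m : D ⇒ F} {f : A ⇒ D} {g : B ⇒ F} →
                 E e → M m → g ∘ e ≈ m ∘ f →
                 Σ[ d ∈ B ⇒ D ] ((d ∘ e ≈ f × m ∘ d ≈ g) ×
                                 (∀ (d' : B ⇒ D) → d' ∘ e ≈ f → m ∘ d' ≈ g → d' ≈ d))

  id-FPC : ∀ {A B} (f : A ⇒ B) → IsFPC f id id f
  id-FPC {A} {B} f = record
    { pullback = pb
    ; universal = λ {X} {Y} {z} {y} {d} P x eq → x ∘ u P
    ; g∘universal = λ {X} {Y} {z} {y} {d} {P} {x} {eq} → begin
        f ∘ (x ∘ u P)   ≈⟨ assoc ⟨
        (f ∘ x) ∘ u P   ≈⟨ ∘ˡ eq ⟩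
        z ∘ u P         ≈⟨ IsPullback.p₂∘universal P ⟩
        d ∎
    ; universal∘y = λ {X} {Y} {z} {y} {d} {P} {x} {eq} → begin
        (x ∘ u P) ∘ y   ≈⟨ assoc ⟩
        x ∘ (u P ∘ y)   ≈⟨ ∘ʳ (uy P) ⟩
        x ∘ id          ≈⟨ identityʳ ⟩
        x               ≈⟨ identityˡ ⟨
        id ∘ x ∎
    ; unique = λ {X} {Y} {z} {y} {d} P x eq v e₁ e₂ → begin
        v               ≈⟨ identityʳ ⟨
        v ∘ id          ≈⟨ ∘ʳ (IsPullback.p₁∘universal P) ⟨
        v ∘ (y ∘ u P)   ≈⟨ assoc ⟨
        (v ∘ y) ∘ u P   ≈⟨ ∘ˡ (≈-trans e₂ identityˡ) ⟩
        x ∘ u P ∎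
    }
    where
    open HomReasoning
    pb : IsPullback id f f id
    pb = record
      { commute = ≈-trans identityʳ (≈-sym identityˡ)
      ; universal = λ h₁ h₂ eq → h₁
      ; p₁∘universal = identityˡ
      ; p₂∘universal = λ {X} {h₁} {h₂} {eq} → ≈-trans eq identityˡ
      ; unique = λ eq v e₁ e₂ → ≈-trans (≈-sym identityˡ) e₁
      }
    u : ∀ {X Y} {z : X ⇒ B} {y : X ⇒ Y} {d : Y ⇒ B} → IsPullback y z d id → Y ⇒ X
    u {d = d} P = IsPullback.universal P id d (≈-trans identityʳ (≈-sym identityˡ))
    uy : ∀ {X Y} {z : X ⇒ B} {y : X ⇒ Y} {d : Y ⇒ B} (P : IsPullback y z d id) →
         u P ∘ y ≈ id
    uy {z = z} {y} {d} P = IsPullback.unique-diagram P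
      (begin
        y ∘ (u P ∘ y)  ≈⟨ assoc ⟨
        (y ∘ u P) ∘ y  ≈⟨ ∘ˡ (IsPullback.p₁∘universal P) ⟩
        id ∘ y         ≈⟨ identityˡ ⟩
        y              ≈⟨ identityʳ ⟨
        y ∘ id ∎)
      (begin
        z ∘ (u P ∘ y)  ≈⟨ assoc ⟨
        (z ∘ u P) ∘ y  ≈⟨ ∘ˡ (IsPullback.p₂∘universal P) ⟩
        d ∘ y          ≈⟨ IsPullback.commute P ⟩
        id ∘ z         ≈⟨ identityˡ ⟩
        z              ≈⟨ identityʳ ⟨
        z ∘ id ∎)

  pb-paste : ∀ {A B A' B' A'' B''}
    {f : A ⇒ B} {β : B ⇒ B'} {α : A ⇒ A'} {f' : A' ⇒ B'}
    {β' : B' ⇒ B''} {α' : A' ⇒ A''} {f'' : A'' ⇒ B''} →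
    IsPullback α f f' β → IsPullback α' f' f'' β' →
    IsPullback (α' ∘ α) f f'' (β' ∘ β)
  pb-paste {f = f} {β} {α} {f'} {β'} {α'} {f''} P₁ P₂ = record
    { commute = begin
        f'' ∘ (α' ∘ α)  ≈⟨ assoc ⟨
        (f'' ∘ α') ∘ α  ≈⟨ ∘ˡ (P₂.commute) ⟩
        (β' ∘ f') ∘ α   ≈⟨ assoc ⟩
        β' ∘ (f' ∘ α)   ≈⟨ ∘ʳ P₁.commute ⟩
        β' ∘ (β ∘ f)    ≈⟨ assoc ⟨
        (β' ∘ β) ∘ f ∎
    ; universal = λ h₁ h₂ eq → U h₁ h₂ eq
    ; p₁∘universal = λ {X} {h₁} {h₂} {eq} → begin
        (α' ∘ α) ∘ U h₁ h₂ eq   ≈⟨ assoc ⟩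
        α' ∘ (α ∘ U h₁ h₂ eq)   ≈⟨ ∘ʳ P₁.p₁∘universal ⟩
        α' ∘ U₁ h₁ h₂ eq        ≈⟨ P₂.p₁∘universal ⟩
        h₁ ∎
    ; p₂∘universal = P₁.p₂∘universal
    ; unique = λ {X} {h₁} {h₂} eq v e₁ e₂ →
        P₁.unique _ v
          (P₂.unique _ (α ∘ v) (≈-trans (≈-sym assoc) e₁)
            (begin
              f' ∘ (α ∘ v)   ≈⟨ assoc ⟨
              (f' ∘ α) ∘ v   ≈⟨ ∘ˡ P₁.commute ⟩
              (β ∘ f) ∘ v    ≈⟨ assoc ⟩
              β ∘ (f ∘ v)    ≈⟨ ∘ʳ e₂ ⟩
              β ∘ h₂ ∎))
          e₂
    }
    where
    open HomReasoning
    module P₁ = IsPullback P₁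
    module P₂ = IsPullback P₂
    U₁ : ∀ {X} (h₁ : X ⇒ _) (h₂ : X ⇒ _) → f'' ∘ h₁ ≈ (β' ∘ β) ∘ h₂ → X ⇒ _
    U₁ h₁ h₂ eq = P₂.universal h₁ (β ∘ h₂) (≈-trans eq assoc)
    U : ∀ {X} (h₁ : X ⇒ _) (h₂ : X ⇒ _) → f'' ∘ h₁ ≈ (β' ∘ β) ∘ h₂ → X ⇒ _
    U h₁ h₂ eq = P₁.universal (U₁ h₁ h₂ eq) h₂ P₂.p₂∘universal

  pb-cancel : ∀ {X Y Q B B' B''}
    {y : X ⇒ Y} {z : X ⇒ B} {d : Y ⇒ B''} {β : B ⇒ B'} {β' : B' ⇒ B''}
    {q₁ : Q ⇒ Y} {q₂ : Q ⇒ B'} →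
    (R : IsPullback q₁ q₂ d β') → (O : IsPullback y z d (β' ∘ β)) →
    IsPullback (IsPullback.universal R y (β ∘ z) (≈-trans (IsPullback.commute O) assoc))
               z q₂ β
  pb-cancel {X} {Y} {Q} {B} {B'} {B''} {y} {z} {d} {β} {β'} {q₁} {q₂} R O = record
    { commute = R.p₂∘universal
    ; universal = W
    ; p₁∘universal = λ {W'} {h₁} {h₂} {eq} → R.unique-diagram
        (begin
          q₁ ∘ (k ∘ W h₁ h₂ eq)  ≈⟨ assoc ⟨
          (q₁ ∘ k) ∘ W h₁ h₂ eq  ≈⟨ ∘ˡ R.p₁∘universal ⟩
          y ∘ W h₁ h₂ eq         ≈⟨ O.p₁∘universal ⟩
          q₁ ∘ h₁ ∎)
        (begin
          q₂ ∘ (k ∘ W h₁ h₂ eq)  ≈⟨ assoc ⟨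
          (q₂ ∘ k) ∘ W h₁ h₂ eq  ≈⟨ ∘ˡ R.p₂∘universal ⟩
          (β ∘ z) ∘ W h₁ h₂ eq   ≈⟨ assoc ⟩
          β ∘ (z ∘ W h₁ h₂ eq)   ≈⟨ ∘ʳ O.p₂∘universal ⟩
          β ∘ h₂                 ≈⟨ eq ⟨
          q₂ ∘ h₁ ∎)
    ; p₂∘universal = O.p₂∘universal
    ; unique = λ {W'} {h₁} {h₂} eq v e₁ e₂ → O.unique _ v
        (begin
          y ∘ v           ≈⟨ ∘ˡ R.p₁∘universal ⟨
          (q₁ ∘ k) ∘ v    ≈⟨ assoc ⟩
          q₁ ∘ (k ∘ v)    ≈⟨ ∘ʳ e₁ ⟩
          q₁ ∘ h₁ ∎)
        e₂
    }
    where
    open HomReasoning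
    module R = IsPullback R
    module O = IsPullback O
    k = R.universal y (β ∘ z) (≈-trans O.commute assoc)
    W : ∀ {W'} (h₁ : W' ⇒ _) (h₂ : W' ⇒ B) → q₂ ∘ h₁ ≈ β ∘ h₂ → W' ⇒ X
    W h₁ h₂ eq = O.universal (q₁ ∘ h₁) h₂ (begin
      d ∘ (q₁ ∘ h₁)   ≈⟨ assoc ⟨
      (d ∘ q₁) ∘ h₁   ≈⟨ ∘ˡ R.commute ⟩
      (β' ∘ q₂) ∘ h₁  ≈⟨ assoc ⟩
      β' ∘ (q₂ ∘ h₁)  ≈⟨ ∘ʳ eq ⟩
      β' ∘ (β ∘ h₂)   ≈⟨ assoc ⟨
      (β' ∘ β) ∘ h₂ ∎)

  fpc-paste : ∀ {A B A' B' A'' B''}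
    {f : A ⇒ B} {β : B ⇒ B'} {α : A ⇒ A'} {f' : A' ⇒ B'}
    {β' : B' ⇒ B''} {α' : A' ⇒ A''} {f'' : A'' ⇒ B''} →
    (∀ {Y} (d : Y ⇒ B'') → Σ[ Q ∈ Obj ] Σ[ q₁ ∈ Q ⇒ Y ] Σ[ q₂ ∈ Q ⇒ B' ]
                             IsPullback q₁ q₂ d β') →
    IsFPC f β α f' → IsFPC f' β' α' f'' →
    IsFPC f (β' ∘ β) (α' ∘ α) f''
  fpc-paste {A} {B} {A'} {B'} {A''} {B''} {f} {β} {α} {f'} {β'} {α'} {f''} pbs F₁ F₂ = record
    { pullback = pb-paste F₁.pullback F₂.pullback
    ; universal = X'
    ; g∘universal = F₂.g∘universal
    ; universal∘y = λ {X} {Y} {z} {y} {d} {P} {x} {eq} → begin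
        X' P x eq ∘ y                   ≈⟨ ∘ʳ (IsPullback.p₁∘universal (R d)) ⟨
        X' P x eq ∘ (q₁ d ∘ k P)        ≈⟨ assoc ⟨
        (X' P x eq ∘ q₁ d) ∘ k P        ≈⟨ ∘ˡ F₂.universal∘y ⟩
        (α' ∘ X₁ P x eq) ∘ k P          ≈⟨ assoc ⟩
        α' ∘ (X₁ P x eq ∘ k P)          ≈⟨ ∘ʳ F₁.universal∘y ⟩
        α' ∘ (α ∘ x)                    ≈⟨ assoc ⟨
        (α' ∘ α) ∘ x ∎
    ; unique = λ {X} {Y} {z} {y} {d} P x eq v e₁ e₂ →
        let module P₂ = IsPullback F₂.pullback
            module Rd = IsPullback (R d)
            weq : f'' ∘ (v ∘ q₁ d) ≈ β' ∘ q₂ d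
            weq = begin
              f'' ∘ (v ∘ q₁ d)  ≈⟨ assoc ⟨
              (f'' ∘ v) ∘ q₁ d  ≈⟨ ∘ˡ e₁ ⟩
              d ∘ q₁ d          ≈⟨ Rd.commute ⟩
              β' ∘ q₂ d ∎
            w = P₂.universal (v ∘ q₁ d) (q₂ d) weq
            wk : w ∘ k P ≈ α ∘ x
            wk = P₂.unique-diagram
              (begin
                α' ∘ (w ∘ k P)      ≈⟨ assoc ⟨
                (α' ∘ w) ∘ k P      ≈⟨ ∘ˡ P₂.p₁∘universal ⟩
                (v ∘ q₁ d) ∘ k P    ≈⟨ assoc ⟩
                v ∘ (q₁ d ∘ k P)    ≈⟨ ∘ʳ Rd.p₁∘universal ⟩
                v ∘ y               ≈⟨ e₂ ⟩
                (α' ∘ α) ∘ x        ≈⟨ assoc ⟩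
                α' ∘ (α ∘ x) ∎)
              (begin
                f' ∘ (w ∘ k P)      ≈⟨ assoc ⟨
                (f' ∘ w) ∘ k P      ≈⟨ ∘ˡ P₂.p₂∘universal ⟩
                q₂ d ∘ k P          ≈⟨ Rd.p₂∘universal ⟩
                β ∘ z               ≈⟨ ∘ʳ eq ⟨
                β ∘ (f ∘ x)         ≈⟨ assoc ⟨
                (β ∘ f) ∘ x         ≈⟨ ∘ˡ (IsPullback.commute F₁.pullback) ⟨
                (f' ∘ α) ∘ x        ≈⟨ assoc ⟩
                f' ∘ (α ∘ x) ∎)
            w≈ : w ≈ X₁ P x eq
            w≈ = F₁.unique (L P) x eq w P₂.p₂∘universal wk
        in F₂.unique (R d) (X₁ P x eq) F₁.g∘universal v e₁
             (≈-trans (≈-sym P₂.p₁∘universal) (∘ʳ w≈))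
    }
    where
    open HomReasoning
    module F₁ = IsFPC F₁
    module F₂ = IsFPC F₂
    Qo : ∀ {Y} → Y ⇒ B'' → Obj
    Qo d = proj₁ (pbs d)
    q₁ : ∀ {Y} (d : Y ⇒ B'') → Qo d ⇒ Y
    q₁ d = proj₁ (proj₂ (pbs d))
    q₂ : ∀ {Y} (d : Y ⇒ B'') → Qo d ⇒ B'
    q₂ d = proj₁ (proj₂ (proj₂ (pbs d)))
    R : ∀ {Y} (d : Y ⇒ B'') → IsPullback (q₁ d) (q₂ d) d β'
    R d = proj₂ (proj₂ (proj₂ (pbs d)))
    k : ∀ {X Y} {z : X ⇒ B} {y : X ⇒ Y} {d : Y ⇒ B''} →
        IsPullback y z d (β' ∘ β) → X ⇒ Qo d
    k {z = z} {y} {d} P =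
      IsPullback.universal (R d) y (β ∘ z) (≈-trans (IsPullback.commute P) assoc)
    L : ∀ {X Y} {z : X ⇒ B} {y : X ⇒ Y} {d : Y ⇒ B''} →
        (P : IsPullback y z d (β' ∘ β)) → IsPullback (k P) z (q₂ d) β
    L {d = d} P = pb-cancel (R d) P
    X₁ : ∀ {X Y} {z : X ⇒ B} {y : X ⇒ Y} {d : Y ⇒ B''} →
         (P : IsPullback y z d (β' ∘ β)) (x : X ⇒ A) → f ∘ x ≈ z → Qo d ⇒ A'
    X₁ P x eq = F₁.universal (L P) x eq
    X' : ∀ {X Y} {z : X ⇒ B} {y : X ⇒ Y} {d : Y ⇒ B''} →
         (P : IsPullback y z d (β' ∘ β)) (x : X ⇒ A) → f ∘ x ≈ z → Y ⇒ A''
    X' {d = d} P x eq = F₂.universal (R d) (X₁ P x eq) F₁.g∘universal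

module FPCv {o ℓ e p} (C : Category o ℓ e) (M : MorClass C p) where
  open Category C
  open Notions C

  record Arr : Set (o ⊔ ℓ) where
    constructor arr
    field
      {dom cod} : Obj
      mor       : dom ⇒ cod

  record FPCSquare (F F' : Arr) : Set (o ⊔ ℓ ⊔ e ⊔ p) where
    private
      module F  = Arr F
      module F' = Arr F'
    field
      α   : F.dom ⇒ F'.dom
      β   : F.cod ⇒ F'.cod
      α∈M : M α
      β∈M : M β
      comm : β ∘ F.mor ≈ F'.mor ∘ α
      fpc : IsFPC F.mor β α F'.mor

  FPCv : StableSystem M → HasPullbacksAlong M → Category (o ⊔ ℓ) (o ⊔ ℓ ⊔ e ⊔ p) e
  FPCv SM pbs = record
    { Obj = Arr
    ; _⇒_ = FPCSquare
    ; _≈_ = λ s t → FPCSquare.α s ≈ FPCSquare.α t × FPCSquare.β s ≈ FPCSquare.β t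
    ; id = λ {F} → record
        { α = id ; β = id
        ; α∈M = StableSystem.iso∈ SM (id , identityˡ , identityˡ)
        ; β∈M = StableSystem.iso∈ SM (id , identityˡ , identityˡ)
        ; comm = ≈-trans identityˡ (≈-sym identityʳ)
        ; fpc = id-FPC (Arr.mor F) }
    ; _∘_ = λ t s → record
        { α = FPCSquare.α t ∘ FPCSquare.α s
        ; β = FPCSquare.β t ∘ FPCSquare.β s
        ; α∈M = StableSystem.comp SM (FPCSquare.α∈M s) (FPCSquare.α∈M t)
        ; β∈M = StableSystem.comp SM (FPCSquare.β∈M s) (FPCSquare.β∈M t)
        ; comm = ≈-sym (IsPullback.commute (IsFPC.pullback
                   (fpc-paste (λ d → pbs d (FPCSquare.β t) (FPCSquare.β∈M t))
                              (FPCSquare.fpc s) (FPCSquare.fpc t))))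
        ; fpc = fpc-paste (λ d → pbs d (FPCSquare.β t) (FPCSquare.β∈M t))
                          (FPCSquare.fpc s) (FPCSquare.fpc t) }
    ; equiv = record
        { refl = ≈-refl , ≈-refl
        ; sym = λ (a , b) → ≈-sym a , ≈-sym b
        ; trans = λ (a , b) (c , d) → ≈-trans a c , ≈-trans b d }
    ; ∘-resp-≈ = λ (a , b) (c , d) → ∘-resp-≈ a c , ∘-resp-≈ b d
    ; assoc = assoc , assoc
    ; identityˡ = identityˡ , identityˡ
    ; identityʳ = identityʳ , identityʳ
    }

  module _ {q} (E : MorClass C q) where
    AutoAugmented : ∀ {F F'} → FPCSquare F F' → Set (o ⊔ ℓ ⊔ e ⊔ q)
    AutoAugmented {F} {F'} s =
      Σ[ P ∈ Obj ] Σ[ pp ∈ Arr.dom F' ⇒ P ] Σ[ qq ∈ Arr.cod F ⇒ P ]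
        (IsPushout (FPCSquare.α s) (Arr.mor F) pp qq ×
         Σ[ u ∈ P ⇒ Arr.cod F' ]
           (u ∘ pp ≈ Arr.mor F' × u ∘ qq ≈ FPCSquare.β s × E u))

    Inert : ∀ {F F'} → FPCSquare F F' → Set (p ⊔ q)
    Inert s = E (FPCSquare.α s) × M (FPCSquare.α s)

{-# OPTIONS --safe #-}
module Submission where

open import Level using (_⊔_)
open import Data.Product using (_×_; _,_; proj₁; proj₂; Σ-syntax)
open import Defs
open Notions using (StableSystem; EMStructured; HasPullbacksAlong; HasPushoutsAlong; HasFPCsAlong; StableUnderPushout; PushoutsStableUnderMPullbacks)
open FPCv using (FPCv; AutoAugmented; Inert)

-- An FPC square (α , β) : f → f′ factors through the pushout (p , q) of α
-- and f: factor the comparison u : P → B′ as m ∘ e with e ∈ E and m ∈ M.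
-- The upper square (α , e ∘ q) : f → e ∘ p is auto-augmented with comparison
-- e, and the lower square (id , m) : e ∘ p → f′ is inert.  Both are FPC
-- squares: the upper one because FPC squares can be cancelled against a
-- square with invertible domain side and monic codomain side, the lower one
-- because it is isomorphic to a genuine FPC of (e ∘ p , m).  A diagonal
-- fill-in is obtained on codomains from the (E , M)-diagonal of u against the
-- codomain side of the inert square, and on domains by inverting the domain
-- side of the inert square.

module CategoryFacts {o ℓ r} (C : Category o ℓ r) where
  open Category C
  open Notions C
  open HomReasoning

  pullˡ : ∀ {W X Y Z} {a : Y ⇒ Z} {b : X ⇒ Y} {c : X ⇒ Z} {x : W ⇒ X} →
          a ∘ b ≈ c → a ∘ (b ∘ x) ≈ c ∘ x
  pullˡ eq = ≈-trans (≈-sym assoc) (∘ˡ eq)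

  pullʳ : ∀ {W X Y Z} {a : Y ⇒ Z} {b : X ⇒ Y} {c : W ⇒ Y} {x : W ⇒ X} →
          b ∘ x ≈ c → (a ∘ b) ∘ x ≈ a ∘ c
  pullʳ eq = ≈-trans assoc (∘ʳ eq)

  cancelˡ : ∀ {W X Y} {a : Y ⇒ X} {b : X ⇒ Y} {x : W ⇒ X} → a ∘ b ≈ id → a ∘ (b ∘ x) ≈ x
  cancelˡ eq = ≈-trans (pullˡ eq) identityˡ

  cancelʳ : ∀ {W X Y} {a : X ⇒ Y} {b : Y ⇒ X} {x : Y ⇒ W} → a ∘ b ≈ id → (x ∘ a) ∘ b ≈ x
  cancelʳ eq = ≈-trans (pullʳ eq) identityʳ

  id-iso : ∀ {A} → IsIso (id {A})
  id-iso = id , identityˡ , identityˡ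

  IsPullback-resp-≈ : ∀ {P A B Z} {p₁ : P ⇒ A} {p₂ : P ⇒ B} {f : A ⇒ Z} {g g′ : B ⇒ Z} →
                      g ≈ g′ → IsPullback p₁ p₂ f g → IsPullback p₁ p₂ f g′
  IsPullback-resp-≈ {A = A} {B} {f = f} {g} {g′} g≈g′ pb = record
    { commute      = ≈-trans P.commute (∘ˡ g≈g′)
    ; universal    = λ h₁ h₂ eq → P.universal h₁ h₂ (back eq)
    ; p₁∘universal = P.p₁∘universal
    ; p₂∘universal = P.p₂∘universal
    ; unique       = λ eq → P.unique (back eq)
    }
    where
    module P = IsPullback pb
    back : ∀ {X} {h₁ : X ⇒ A} {h₂ : X ⇒ B} → f ∘ h₁ ≈ g′ ∘ h₂ → f ∘ h₁ ≈ g ∘ h₂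
    back eq = ≈-trans eq (∘ˡ (≈-sym g≈g′))

  IsPullback-∘-mono : ∀ {P A B X Z} {p₁ : P ⇒ A} {p₂ : P ⇒ B} {f : A ⇒ X} {g : B ⇒ X}
                      {m : X ⇒ Z} {g′ : B ⇒ Z} →
                      Mono m → m ∘ g ≈ g′ → IsPullback p₁ p₂ f g → IsPullback p₁ p₂ (m ∘ f) g′
  IsPullback-∘-mono {A = A} {B} {p₁ = p₁} {p₂} {f} {g} {m} {g′} mono m∘g≈g′ pb = record
    { commute      = begin
        (m ∘ f) ∘ p₁  ≈⟨ pullʳ P.commute ⟩
        m ∘ (g ∘ p₂)  ≈⟨ pullˡ m∘g≈g′ ⟩
        g′ ∘ p₂       ∎
    ; universal    = λ h₁ h₂ eq → P.universal h₁ h₂ (back eq)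
    ; p₁∘universal = P.p₁∘universal
    ; p₂∘universal = P.p₂∘universal
    ; unique       = λ eq → P.unique (back eq)
    }
    where
    module P = IsPullback pb
    back : ∀ {X} {h₁ : X ⇒ A} {h₂ : X ⇒ B} → (m ∘ f) ∘ h₁ ≈ g′ ∘ h₂ → f ∘ h₁ ≈ g ∘ h₂
    back {h₁ = h₁} {h₂} eq = mono _ _ (begin
      m ∘ (f ∘ h₁)  ≈⟨ assoc ⟨
      (m ∘ f) ∘ h₁  ≈⟨ eq ⟩
      g′ ∘ h₂       ≈⟨ ∘ˡ m∘g≈g′ ⟨
      (m ∘ g) ∘ h₂  ≈⟨ assoc ⟩
      m ∘ (g ∘ h₂)  ∎)

  IsPushout-unique-diagram : ∀ {Z A B Q X} {a : Z ⇒ A} {f : Z ⇒ B} {i₁ : A ⇒ Q} {i₂ : B ⇒ Q} →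
    IsPushout a f i₁ i₂ → {v w : Q ⇒ X} → v ∘ i₁ ≈ w ∘ i₁ → v ∘ i₂ ≈ w ∘ i₂ → v ≈ w
  IsPushout-unique-diagram {a = a} {f} {i₁} {i₂} po {v} {w} e₁ e₂ =
    ≈-trans (P.unique eq v ≈-refl ≈-refl) (≈-sym (P.unique eq w (≈-sym e₁) (≈-sym e₂)))
    where
    module P = IsPushout po
    eq : (v ∘ i₁) ∘ a ≈ (v ∘ i₂) ∘ f
    eq = ≈-trans (pullʳ P.commute) (≈-sym assoc)

  IsPushout-transport : ∀ {Z A B Q Z₀ A₀ B₀}
    {a : Z ⇒ A} {f : Z ⇒ B} {i₁ : A ⇒ Q} {i₂ : B ⇒ Q}
    {a₀ : Z₀ ⇒ A₀} {f₀ : Z₀ ⇒ B₀} {φ : Z₀ ⇒ Z} {κ : A₀ ⇒ A} {ψ : B₀ ⇒ B} →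
    IsIso φ → IsIso κ → IsIso ψ → a ∘ φ ≈ κ ∘ a₀ → f ∘ φ ≈ ψ ∘ f₀ →
    IsPushout a f i₁ i₂ → IsPushout a₀ f₀ (i₁ ∘ κ) (i₂ ∘ ψ)
  IsPushout-transport {Z} {Z₀ = Z₀} {A₀} {B₀} {a = a} {f} {i₁} {i₂} {a₀} {f₀} {φ} {κ} {ψ}
                      (φ⁻ , _ , φφ⁻) (κ⁻ , κ⁻κ , κκ⁻) (ψ⁻ , ψ⁻ψ , ψψ⁻) aφ fφ po = record
    { commute      = begin
        (i₁ ∘ κ) ∘ a₀  ≈⟨ pullʳ (≈-sym aφ) ⟩
        i₁ ∘ (a ∘ φ)   ≈⟨ pullˡ P.commute ⟩
        (i₂ ∘ f) ∘ φ   ≈⟨ pullʳ fφ ⟩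
        i₂ ∘ (ψ ∘ f₀)  ≈⟨ assoc ⟨
        (i₂ ∘ ψ) ∘ f₀  ∎
    ; universal    = λ h₁ h₂ eq → P.universal (h₁ ∘ κ⁻) (h₂ ∘ ψ⁻) (untransport eq)
    ; universal∘i₁ = ≈-trans (≈-sym assoc) (≈-trans (∘ˡ P.universal∘i₁) (cancelʳ κ⁻κ))
    ; universal∘i₂ = ≈-trans (≈-sym assoc) (≈-trans (∘ˡ P.universal∘i₂) (cancelʳ ψ⁻ψ))
    ; unique       = λ eq v e₁ e₂ →
        P.unique (untransport eq) v (transpose κκ⁻ (≈-trans assoc e₁)) (transpose ψψ⁻ (≈-trans assoc e₂))
    }
    where
    module P = IsPushout po
    transpose : ∀ {U V W} {x : V ⇒ W} {c : U ⇒ V} {c⁻ : V ⇒ U} {y : U ⇒ W} →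
                c ∘ c⁻ ≈ id → x ∘ c ≈ y → x ≈ y ∘ c⁻
    transpose {x = x} {c} {c⁻} {y} cc⁻ xc = begin
      x               ≈⟨ cancelʳ cc⁻ ⟨
      (x ∘ c) ∘ c⁻    ≈⟨ ∘ˡ xc ⟩
      y ∘ c⁻          ∎
    conjugate : ∀ {U V X} {b : Z ⇒ U} {c : V ⇒ U} {c⁻ : U ⇒ V} {b₀ : Z₀ ⇒ V} (h : V ⇒ X) →
                c⁻ ∘ c ≈ id → b ∘ φ ≈ c ∘ b₀ → (h ∘ c⁻) ∘ b ≈ (h ∘ b₀) ∘ φ⁻
    conjugate {b = b} {c} {c⁻} {b₀} h c⁻c bφ = begin
      (h ∘ c⁻) ∘ b                ≈⟨ ∘ʳ (transpose φφ⁻ bφ) ⟩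
      (h ∘ c⁻) ∘ ((c ∘ b₀) ∘ φ⁻)  ≈⟨ pullʳ (pullˡ (cancelˡ c⁻c)) ⟩
      h ∘ (b₀ ∘ φ⁻)               ≈⟨ assoc ⟨
      (h ∘ b₀) ∘ φ⁻               ∎
    untransport : ∀ {X} {h₁ : A₀ ⇒ X} {h₂ : B₀ ⇒ X} →
                  h₁ ∘ a₀ ≈ h₂ ∘ f₀ → (h₁ ∘ κ⁻) ∘ a ≈ (h₂ ∘ ψ⁻) ∘ f
    untransport {h₁ = h₁} {h₂} eq = begin
      (h₁ ∘ κ⁻) ∘ a   ≈⟨ conjugate h₁ κ⁻κ aφ ⟩
      (h₁ ∘ a₀) ∘ φ⁻  ≈⟨ ∘ˡ eq ⟩
      (h₂ ∘ f₀) ∘ φ⁻  ≈⟨ conjugate h₂ ψ⁻ψ fφ ⟨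
      (h₂ ∘ ψ⁻) ∘ f   ∎

  upper-square-fpc : ∀ {A B A′ B′ A″ B″} {f : A ⇒ B} {f′ : A′ ⇒ B′} {f″ : A″ ⇒ B″}
    {α : A ⇒ A′} {β : B ⇒ B′} {α′ : A′ ⇒ A″} {β′ : B′ ⇒ B″} {γ : A ⇒ A″} {δ : B ⇒ B″} →
    IsIso α′ → Mono β′ → β′ ∘ f′ ≈ f″ ∘ α′ → β ∘ f ≈ f′ ∘ α →
    α′ ∘ α ≈ γ → β′ ∘ β ≈ δ → IsFPC f δ γ f″ → IsFPC f β α f′
  upper-square-fpc {B = B} {A′} {B′} {f′ = f′} {f″} {α} {β} {α′} {β′} {γ} {δ}
                   (ι , ια′ , α′ι) β′-mono lower upper α′α≈γ β′β≈δ outer = record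
    { pullback = record
      { commute      = ≈-sym upper
      ; universal    = λ h₁ h₂ eq → OP.universal (α′ ∘ h₁) h₂ (outer-commute eq)
      ; p₁∘universal = λ {X} {h₁} {h₂} {eq} → begin
          α ∘ OP.universal _ _ _            ≈⟨ cancelˡ ια′ ⟨
          ι ∘ (α′ ∘ (α ∘ OP.universal _ _ _)) ≈⟨ ∘ʳ (pullˡ α′α≈γ) ⟩
          ι ∘ (γ ∘ OP.universal _ _ _)        ≈⟨ ∘ʳ OP.p₁∘universal ⟩
          ι ∘ (α′ ∘ h₁)                       ≈⟨ cancelˡ ια′ ⟩
          h₁                                  ∎
      ; p₂∘universal = OP.p₂∘universal
      ; unique       = λ eq v v₁ v₂ →
          OP.unique (outer-commute eq) v (≈-trans (≈-sym (pullˡ α′α≈γ)) (∘ʳ v₁)) v₂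
      }
    ; universal   = λ pb x eq → ι ∘ O.universal (outer-pb pb) x eq
    ; g∘universal = λ {X} {Y} {z} {y} {d} {pb} {x} {eq} → β′-mono _ _ (begin
        β′ ∘ (f′ ∘ (ι ∘ O.universal _ x eq))  ≈⟨ pullˡ lower ⟩
        (f″ ∘ α′) ∘ (ι ∘ O.universal _ x eq)  ≈⟨ pullʳ (cancelˡ α′ι) ⟩
        f″ ∘ O.universal _ x eq               ≈⟨ O.g∘universal ⟩
        β′ ∘ d                                ∎)
    ; universal∘y = λ {X} {Y} {z} {y} {d} {pb} {x} {eq} → begin
        (ι ∘ O.universal _ x eq) ∘ y  ≈⟨ pullʳ O.universal∘y ⟩
        ι ∘ (γ ∘ x)                   ≈⟨ ∘ʳ (pullˡ α′α≈γ) ⟨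
        ι ∘ (α′ ∘ (α ∘ x))            ≈⟨ cancelˡ ια′ ⟩
        α ∘ x                         ∎
    ; unique = λ pb x eq v v₁ v₂ →
        let α′v≈ = O.unique (outer-pb pb) x eq (α′ ∘ v)
                     (≈-trans (pullˡ (≈-sym lower)) (pullʳ v₁))
                     (≈-trans (pullʳ v₂) (pullˡ α′α≈γ))
        in ≈-trans (≈-sym (cancelˡ ια′)) (∘ʳ α′v≈)
    }
    where
    module O = IsFPC outer
    module OP = IsPullback O.pullback
    outer-commute : ∀ {X} {h₁ : X ⇒ A′} {h₂ : X ⇒ B} → f′ ∘ h₁ ≈ β ∘ h₂ → f″ ∘ (α′ ∘ h₁) ≈ δ ∘ h₂
    outer-commute eq = ≈-trans (pullˡ (≈-sym lower)) (≈-trans (pullʳ eq) (pullˡ β′β≈δ))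
    outer-pb : ∀ {X Y} {y : X ⇒ Y} {z : X ⇒ B} {d : Y ⇒ B′} →
               IsPullback y z d β → IsPullback y z (β′ ∘ d) δ
    outer-pb = IsPullback-∘-mono β′-mono β′β≈δ

  lower-square-fpc : ∀ {A B A′ B′ X F} {f : A ⇒ B} {f′ : A′ ⇒ B′} {α : A ⇒ A′} {β : B ⇒ B′}
    {g : A′ ⇒ X} {γ : B ⇒ X} {m : X ⇒ B′} {n : A′ ⇒ F} {h : F ⇒ B′} {j : A′ ⇒ A′} →
    IsFPC f β α f′ → IsFPC g m n h → Mono m → m ∘ g ≈ f′ → m ∘ γ ≈ β →
    IsPullback α f g γ → j ≈ id → IsFPC g m j f′
  lower-square-fpc {A′ = A′} {F = F} {f′ = f′} {n = n} {h} {j}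
                   outer fpc m-mono mg≈f′ mγ≈β upper j≈id = record
    { pullback = record
      { commute      = ≈-trans (∘ʳ j≈id) (≈-trans identityʳ (≈-sym mg≈f′))
      ; universal    = λ h₁ h₂ eq → h₁
      ; p₁∘universal = ≈-trans (∘ˡ j≈id) identityˡ
      ; p₂∘universal = λ {X} {h₁} {h₂} {eq} → m-mono _ _ (≈-trans (pullˡ mg≈f′) eq)
      ; unique       = λ eq v v₁ v₂ → ≈-trans (≈-sym (≈-trans (∘ˡ j≈id) identityˡ)) v₁
      }
    ; universal   = λ pb x eq → ψ ∘ N.universal pb x eq
    ; g∘universal = ≈-trans (pullˡ f′ψ≈h) N.g∘universal
    ; universal∘y = λ {X} {Y} {z} {y} {d} {pb} {x} {eq} → begin
        (ψ ∘ N.universal pb x eq) ∘ y  ≈⟨ pullʳ N.universal∘y ⟩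
        ψ ∘ (n ∘ x)                    ≈⟨ pullˡ ψn≈id ⟩
        id ∘ x                         ≈⟨ ∘ˡ j≈id ⟨
        j ∘ x                          ∎
    ; unique = λ pb x eq v v₁ v₂ →
        let nv≈ = N.unique pb x eq (n ∘ v)
                    (≈-trans (pullˡ NP.commute) (≈-trans (∘ˡ mg≈f′) v₁))
                    (≈-trans (pullʳ v₂) (∘ʳ (≈-trans (∘ˡ j≈id) identityˡ)))
        in begin
          v            ≈⟨ identityˡ ⟨
          id ∘ v       ≈⟨ ∘ˡ ψn≈id ⟨
          (ψ ∘ n) ∘ v  ≈⟨ pullʳ nv≈ ⟩
          ψ ∘ N.universal pb x eq ∎
    }
    where
    module O = IsFPC outer
    module N = IsFPC fpc
    module NP = IsPullback N.pullback
    -- Finality of the outer square gives a retraction ψ of n, which transfers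
    -- finality from (n , h) to (j , f′).
    ψ : F ⇒ A′
    ψ = O.universal (IsPullback-resp-≈ mγ≈β (pb-paste upper N.pullback)) id identityʳ
    f′ψ≈h : f′ ∘ ψ ≈ h
    f′ψ≈h = O.g∘universal
    ψn≈id : ψ ∘ n ≈ id
    ψn≈id = ≈-trans
      (O.unique O.pullback id identityʳ (ψ ∘ n)
        (≈-trans (pullˡ f′ψ≈h) (≈-trans NP.commute mg≈f′))
        (≈-trans assoc O.universal∘y))
      (≈-sym (O.unique O.pullback id identityʳ id identityʳ
        (≈-trans identityˡ (≈-sym identityʳ))))

module FactorisationFacts {o ℓ r ℓE ℓM} (C : Category o ℓ r) (E : MorClass C ℓE) (M : MorClass C ℓM)
  (SM : StableSystem C M) (EM : EMStructured C E M) where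
  open Category C
  open Notions C using (IsIso)
  open CategoryFacts C
  open StableSystem SM using (comp; iso∈)
  open EMStructured EM

  E∩M⇒iso : ∀ {A B} {h : A ⇒ B} → E h → M h → IsIso h
  E∩M⇒iso h∈E h∈M with diagonal {f = id} {g = id} h∈E h∈M (≈-trans identityˡ (≈-sym identityʳ))
  ... | h⁻ , (h⁻h , hh⁻) , _ = h⁻ , h⁻h , hh⁻

  E-retraction⇒iso : ∀ {A B Z} {e : A ⇒ B} {r : B ⇒ A} {k : B ⇒ Z} →
                     E e → M k → r ∘ e ≈ id → k ∘ (e ∘ r) ≈ k → IsIso e
  E-retraction⇒iso {e = e} {r} {k} e∈E k∈M re≈id ker≈k with diagonal {f = e} {g = k} e∈E k∈M ≈-refl
  ... | _ , _ , unique = r , re≈id ,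
    ≈-trans (unique (e ∘ r) (cancelʳ re≈id) ker≈k) (≈-sym (unique id identityˡ identityʳ))

  -- Classes of morphisms need not be closed under ≈, so M-membership is
  -- only obtained for a ≈-representative.
  M-cancelˡ : ∀ {X Y Z} {m : X ⇒ Z} {k : Y ⇒ Z} {h : Y ⇒ X} →
              M m → M k → m ∘ h ≈ k → Σ[ h′ ∈ Y ⇒ X ] (h′ ≈ h × M h′)
  M-cancelˡ {m = m} {k} {h} m∈M k∈M mh≈k with factor h
  ... | _ , e , n , e∈E , n∈M , ne≈h
        with diagonal e∈E k∈M (≈-trans (pullʳ ne≈h) (≈-trans mh≈k (≈-sym identityʳ)))
  ... | d , (d∘e≈id , k∘d≈m∘n) , _ =
    n ∘ e , ne≈h , M-isoʳ (E-retraction⇒iso e∈E (comp n∈M m∈M) d∘e≈id mned≈mn) n∈M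
    where
    open HomReasoning
    mned≈mn : (m ∘ n) ∘ (e ∘ d) ≈ m ∘ n
    mned≈mn = begin
      (m ∘ n) ∘ (e ∘ d)  ≈⟨ assoc ⟨
      ((m ∘ n) ∘ e) ∘ d  ≈⟨ ∘ˡ (pullʳ ne≈h) ⟩
      (m ∘ h) ∘ d        ≈⟨ ∘ˡ mh≈k ⟩
      k ∘ d              ≈⟨ k∘d≈m∘n ⟩
      m ∘ n              ∎

  -- Stands in for id, which need not lie in E.
  E∩M-≈id : ∀ A → Σ[ j ∈ A ⇒ A ] (j ≈ id × E j × M j)
  E∩M-≈id A with factor (id {A})
  ... | _ , e , n , e∈E , n∈M , ne≈id =
    n ∘ e , ne≈id , E-isoˡ n-iso e∈E , iso∈ (id , ≈-trans identityˡ ne≈id , ≈-trans identityʳ ne≈id)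
    where
    e-iso : IsIso e
    e-iso = E-retraction⇒iso e∈E n∈M ne≈id (cancelˡ ne≈id)
    n-iso : IsIso n
    n-iso = e , proj₂ (proj₂ e-iso) , ne≈id

module FPCvFactorisation {o ℓ r ℓE ℓM} (C : Category o ℓ r) (E : MorClass C ℓE) (M : MorClass C ℓM)
  (SM : StableSystem C M) (EM : EMStructured C E M) (pbs : HasPullbacksAlong C M)
  (pos : HasPushoutsAlong C M) (fpcs : HasFPCsAlong C M) where
  open Category C
  open Notions C using (IsIso; IsPushout; IsFPC)
  open CategoryFacts C
  open FactorisationFacts C E M SM EM
  open StableSystem SM using (mono)
  open EMStructured EM using (E-isoˡ; E-isoʳ; M-isoˡ; M-isoʳ)
  open FPCv C M using (Arr; arr; FPCSquare)
  open FPCSquare using () renaming (α to αˢ; β to βˢ; α∈M to αˢ∈M; β∈M to βˢ∈M; comm to commˢ; fpc to fpcˢ)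
  open HomReasoning

  D : Category (o ⊔ ℓ) (o ⊔ ℓ ⊔ r ⊔ ℓM) r
  D = FPCv C M SM pbs
  module D = Category D
  open Notions D using () renaming (IsIso to IsIsoᴰ)

  αˢ-iso : ∀ {F F′} (s : FPCSquare F F′) → IsIsoᴰ s → IsIso (αˢ s)
  αˢ-iso _ (t , (tα , _) , (sα , _)) = αˢ t , tα , sα

  βˢ-iso : ∀ {F F′} (s : FPCSquare F F′) → IsIsoᴰ s → IsIso (βˢ s)
  βˢ-iso _ (t , (_ , tβ) , (_ , sβ)) = βˢ t , tβ , sβ

  autoAugmented-isoˡ : ∀ {F F₁ F₂} {s : FPCSquare F F₁} {i : FPCSquare F₁ F₂} →
    IsIsoᴰ i → AutoAugmented C M E s → AutoAugmented C M E (i D.∘ s)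
  autoAugmented-isoˡ {F₁ = arr f₁} {arr f₂} {i = i} i-iso (P , p , q , po , u , up≈f₁ , uq≈β , u∈E)
    with αˢ-iso i i-iso
  ... | κ , κα≈id , ακ≈id =
    P , p ∘ κ , q ∘ id ,
    IsPushout-transport id-iso (αˢ i , ακ≈id , κα≈id) id-iso
      (≈-trans identityʳ (≈-sym (cancelˡ κα≈id))) (≈-trans identityʳ (≈-sym identityˡ)) po ,
    βˢ i ∘ u , u′p′≈f₂ , pullʳ (≈-trans (∘ʳ identityʳ) uq≈β) , E-isoˡ (βˢ-iso i i-iso) u∈E
    where
    u′p′≈f₂ : (βˢ i ∘ u) ∘ (p ∘ κ) ≈ f₂
    u′p′≈f₂ = begin
      (βˢ i ∘ u) ∘ (p ∘ κ)  ≈⟨ pullʳ (pullˡ up≈f₁) ⟩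
      βˢ i ∘ (f₁ ∘ κ)       ≈⟨ pullˡ (commˢ i) ⟩
      (f₂ ∘ αˢ i) ∘ κ       ≈⟨ cancelʳ ακ≈id ⟩
      f₂                    ∎

  autoAugmented-isoʳ : ∀ {F₀ F F₁} {i : FPCSquare F₀ F} {s : FPCSquare F F₁} →
    IsIsoᴰ i → AutoAugmented C M E s → AutoAugmented C M E (s D.∘ i)
  autoAugmented-isoʳ {i = i} i-iso (P , p , q , po , u , up≈f₁ , uq≈β , u∈E) =
    P , p ∘ id , q ∘ βˢ i ,
    IsPushout-transport (αˢ-iso i i-iso) id-iso (βˢ-iso i i-iso)
      (≈-sym identityˡ) (≈-sym (commˢ i)) po ,
    u , ≈-trans (∘ʳ identityʳ) up≈f₁ , ≈-trans (≈-sym assoc) (∘ˡ uq≈β) , u∈E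

  inert-isoˡ : ∀ {F F₁ F₂} {s : FPCSquare F F₁} {i : FPCSquare F₁ F₂} →
    IsIsoᴰ i → Inert C M E s → Inert C M E (i D.∘ s)
  inert-isoˡ {i = i} i-iso (α∈E , α∈M) = E-isoˡ (αˢ-iso i i-iso) α∈E , M-isoˡ (αˢ-iso i i-iso) α∈M

  inert-isoʳ : ∀ {F₀ F F₁} {i : FPCSquare F₀ F} {s : FPCSquare F F₁} →
    IsIsoᴰ i → Inert C M E s → Inert C M E (s D.∘ i)
  inert-isoʳ {i = i} i-iso (α∈E , α∈M) = E-isoʳ (αˢ-iso i i-iso) α∈E , M-isoʳ (αˢ-iso i i-iso) α∈M

  module Factorisation {A B A₁ B₁} {f : A ⇒ B} {f₁ : A₁ ⇒ B₁} (s : FPCSquare (arr f) (arr f₁))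
    {P} {p : A₁ ⇒ P} {q : B ⇒ P} (po : IsPushout (αˢ s) f p q)
    {u : P ⇒ B₁} (up≈f₁ : u ∘ p ≈ f₁) (uq≈β : u ∘ q ≈ βˢ s)
    {X} {e : P ⇒ X} {m : X ⇒ B₁} (e∈E : E e) (m∈M : M m) (me≈u : m ∘ e ≈ u) where

    g : A₁ ⇒ X
    g = e ∘ p

    mg≈f₁ : m ∘ g ≈ f₁
    mg≈f₁ = ≈-trans (pullˡ me≈u) up≈f₁

    γ-spec : Σ[ γ ∈ B ⇒ X ] (γ ≈ e ∘ q × M γ)
    γ-spec = M-cancelˡ m∈M (βˢ∈M s) (≈-trans (pullˡ me≈u) uq≈β)

    γ : B ⇒ X
    γ = proj₁ γ-spec

    γ≈eq : γ ≈ e ∘ q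
    γ≈eq = proj₁ (proj₂ γ-spec)

    mγ≈β : m ∘ γ ≈ βˢ s
    mγ≈β = ≈-trans (∘ʳ γ≈eq) (≈-trans (pullˡ me≈u) uq≈β)

    γf≈gα : γ ∘ f ≈ g ∘ αˢ s
    γf≈gα = mono m∈M _ _ (begin
      m ∘ (γ ∘ f)      ≈⟨ pullˡ mγ≈β ⟩
      βˢ s ∘ f         ≈⟨ commˢ s ⟩
      f₁ ∘ αˢ s        ≈⟨ pullˡ mg≈f₁ ⟨
      m ∘ (g ∘ αˢ s)   ∎)

    j-spec : Σ[ j ∈ A₁ ⇒ A₁ ] (j ≈ id × E j × M j)
    j-spec = E∩M-≈id A₁

    j : A₁ ⇒ A₁
    j = proj₁ j-spec

    j≈id : j ≈ id
    j≈id = proj₁ (proj₂ j-spec)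

    j∈E : E j
    j∈E = proj₁ (proj₂ (proj₂ j-spec))

    j∈M : M j
    j∈M = proj₂ (proj₂ (proj₂ j-spec))

    mg≈f₁j : m ∘ g ≈ f₁ ∘ j
    mg≈f₁j = ≈-trans mg≈f₁ (≈-sym (≈-trans (∘ʳ j≈id) identityʳ))

    jα≈α : j ∘ αˢ s ≈ αˢ s
    jα≈α = ≈-trans (∘ˡ j≈id) identityˡ

    upper : FPCSquare (arr f) (arr g)
    upper = record
      { α = αˢ s ; β = γ ; α∈M = αˢ∈M s ; β∈M = proj₂ (proj₂ γ-spec) ; comm = γf≈gα
      ; fpc = upper-square-fpc (id , ≈-trans identityˡ j≈id , ≈-trans identityʳ j≈id)
                (mono m∈M) mg≈f₁j γf≈gα jα≈α mγ≈β (fpcˢ s) }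

    lower : FPCSquare (arr g) (arr f₁)
    lower = record
      { α = j ; β = m ; α∈M = j∈M ; β∈M = m∈M ; comm = mg≈f₁j
      ; fpc = lower-square-fpc (fpcˢ s) (proj₂ (proj₂ (proj₂ (fpcs g m m∈M)))) (mono m∈M)
                mg≈f₁ mγ≈β (IsFPC.pullback (fpcˢ upper)) j≈id }

    upper-autoAugmented : AutoAugmented C M E upper
    upper-autoAugmented = P , p , q , po , e , ≈-refl , ≈-sym γ≈eq , e∈E

    lower-inert : Inert C M E lower
    lower-inert = j∈E , j∈M

    lower∘upper≈s : lower D.∘ upper D.≈ s
    lower∘upper≈s = jα≈α , mγ≈β

  factorise : ∀ {F F₁} (s : FPCSquare F F₁) →
    Σ[ G ∈ Arr ] Σ[ s₁ ∈ FPCSquare F G ] Σ[ s₂ ∈ FPCSquare G F₁ ]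
      (AutoAugmented C M E s₁ × Inert C M E s₂ × s₂ D.∘ s₁ D.≈ s)
  factorise {arr f} {arr f₁} s with pos (αˢ s) f (αˢ∈M s)
  ... | _ , p , q , po with EMStructured.factor EM (IsPushout.universal po f₁ (βˢ s) (≈-sym (commˢ s)))
  ... | _ , e , m , e∈E , m∈M , me≈u =
    arr g , upper , lower , upper-autoAugmented , lower-inert , lower∘upper≈s
    where
    open Factorisation s po (IsPushout.universal∘i₁ po) (IsPushout.universal∘i₂ po) e∈E m∈M me≈u

  module Diagonal {A₁ B₁ A₂ B₂ A₃ B₃ A₄ B₄}
    {a₁ : A₁ ⇒ B₁} {a₂ : A₂ ⇒ B₂} {a₃ : A₃ ⇒ B₃} {a₄ : A₄ ⇒ B₄}
    {e : FPCSquare (arr a₁) (arr a₂)} {m : FPCSquare (arr a₃) (arr a₄)}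
    {f : FPCSquare (arr a₁) (arr a₃)} {g : FPCSquare (arr a₂) (arr a₄)}
    {P} {p : A₂ ⇒ P} {q : B₁ ⇒ P} (po : IsPushout (αˢ e) a₁ p q)
    {u : P ⇒ B₂} (up≈a₂ : u ∘ p ≈ a₂) (uq≈β : u ∘ q ≈ βˢ e) (u∈E : E u)
    (αm-iso : IsIso (αˢ m)) (ge≈mf : g D.∘ e D.≈ m D.∘ f) where

    module po = IsPushout po

    ι : A₄ ⇒ A₃
    ι = proj₁ αm-iso

    ι∘αˢm≈id : ι ∘ αˢ m ≈ id
    ι∘αˢm≈id = proj₁ (proj₂ αm-iso)

    αˢm∘ι≈id : αˢ m ∘ ι ≈ id
    αˢm∘ι≈id = proj₂ (proj₂ αm-iso)

    α : A₂ ⇒ A₃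
    α = ι ∘ αˢ g

    αˢm∘α≈αˢg : αˢ m ∘ α ≈ αˢ g
    αˢm∘α≈αˢg = cancelˡ αˢm∘ι≈id

    α∘αˢe≈αˢf : α ∘ αˢ e ≈ αˢ f
    α∘αˢe≈αˢf = ≈-trans (pullʳ (proj₁ ge≈mf)) (cancelˡ ι∘αˢm≈id)

    w : P ⇒ B₃
    w = po.universal (a₃ ∘ α) (βˢ f) (≈-trans (pullʳ α∘αˢe≈αˢf) (≈-sym (commˢ f)))

    βˢg∘u≈βˢm∘w : βˢ g ∘ u ≈ βˢ m ∘ w
    βˢg∘u≈βˢm∘w = IsPushout-unique-diagram po
      (begin
        (βˢ g ∘ u) ∘ p    ≈⟨ pullʳ up≈a₂ ⟩
        βˢ g ∘ a₂         ≈⟨ commˢ g ⟩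
        a₄ ∘ αˢ g         ≈⟨ ∘ʳ αˢm∘α≈αˢg ⟨
        a₄ ∘ (αˢ m ∘ α)   ≈⟨ ≈-trans (pullˡ (commˢ m)) assoc ⟨
        βˢ m ∘ (a₃ ∘ α)   ≈⟨ pullʳ po.universal∘i₁ ⟨
        (βˢ m ∘ w) ∘ p    ∎)
      (begin
        (βˢ g ∘ u) ∘ q    ≈⟨ pullʳ uq≈β ⟩
        βˢ g ∘ βˢ e       ≈⟨ proj₂ ge≈mf ⟩
        βˢ m ∘ βˢ f       ≈⟨ pullʳ po.universal∘i₂ ⟨
        (βˢ m ∘ w) ∘ q    ∎)

    lift : Σ[ d₀ ∈ B₂ ⇒ B₃ ] ((d₀ ∘ u ≈ w × βˢ m ∘ d₀ ≈ βˢ g) ×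
             (∀ (d′ : B₂ ⇒ B₃) → d′ ∘ u ≈ w → βˢ m ∘ d′ ≈ βˢ g → d′ ≈ d₀))
    lift = EMStructured.diagonal EM u∈E (βˢ∈M m) βˢg∘u≈βˢm∘w

    d₀ : B₂ ⇒ B₃
    d₀ = proj₁ lift

    βˢm∘d₀≈βˢg : βˢ m ∘ d₀ ≈ βˢ g
    βˢm∘d₀≈βˢg = proj₂ (proj₁ (proj₂ lift))

    β-spec : Σ[ β ∈ B₂ ⇒ B₃ ] (β ≈ d₀ × M β)
    β-spec = M-cancelˡ (βˢ∈M m) (βˢ∈M g) βˢm∘d₀≈βˢg

    β : B₂ ⇒ B₃
    β = proj₁ β-spec

    β≈d₀ : β ≈ d₀
    β≈d₀ = proj₁ (proj₂ β-spec)

    β∘u≈w : β ∘ u ≈ w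
    β∘u≈w = ≈-trans (∘ˡ β≈d₀) (proj₁ (proj₁ (proj₂ lift)))

    βˢm∘β≈βˢg : βˢ m ∘ β ≈ βˢ g
    βˢm∘β≈βˢg = ≈-trans (∘ʳ β≈d₀) βˢm∘d₀≈βˢg

    β∘βˢe≈βˢf : β ∘ βˢ e ≈ βˢ f
    β∘βˢe≈βˢf = ≈-trans (∘ʳ (≈-sym uq≈β)) (≈-trans (pullˡ β∘u≈w) po.universal∘i₂)

    βa₂≈a₃α : β ∘ a₂ ≈ a₃ ∘ α
    βa₂≈a₃α = ≈-trans (∘ʳ (≈-sym up≈a₂)) (≈-trans (pullˡ β∘u≈w) po.universal∘i₁)

    d : FPCSquare (arr a₂) (arr a₃)
    d = record
      { α = α ; β = β
      ; α∈M = M-isoˡ (αˢ m , αˢm∘ι≈id , ι∘αˢm≈id) (αˢ∈M g)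
      ; β∈M = proj₂ (proj₂ β-spec)
      ; comm = βa₂≈a₃α
      ; fpc = upper-square-fpc αm-iso (mono (βˢ∈M m)) (commˢ m) βa₂≈a₃α
                αˢm∘α≈αˢg βˢm∘β≈βˢg (fpcˢ g) }

    d∘e≈f : d D.∘ e D.≈ f
    d∘e≈f = α∘αˢe≈αˢf , β∘βˢe≈βˢf

    m∘d≈g : m D.∘ d D.≈ g
    m∘d≈g = αˢm∘α≈αˢg , βˢm∘β≈βˢg

    d-unique : ∀ (d′ : FPCSquare (arr a₂) (arr a₃)) → d′ D.∘ e D.≈ f → m D.∘ d′ D.≈ g → d′ D.≈ d
    d-unique d′ (_ , β′βˢe≈βˢf) (αˢmα′≈αˢg , βˢmβ′≈βˢg) =
      α′≈α , ≈-trans (proj₂ (proj₂ lift) (βˢ d′) β′u≈w βˢmβ′≈βˢg) (≈-sym β≈d₀)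
      where
      α′≈α : αˢ d′ ≈ α
      α′≈α = ≈-trans (≈-sym (cancelˡ ι∘αˢm≈id)) (∘ʳ αˢmα′≈αˢg)
      β′u≈w : βˢ d′ ∘ u ≈ w
      β′u≈w = IsPushout-unique-diagram po
        (begin
          (βˢ d′ ∘ u) ∘ p  ≈⟨ pullʳ up≈a₂ ⟩
          βˢ d′ ∘ a₂       ≈⟨ commˢ d′ ⟩
          a₃ ∘ αˢ d′       ≈⟨ ∘ʳ α′≈α ⟩
          a₃ ∘ α           ≈⟨ po.universal∘i₁ ⟨
          w ∘ p            ∎)
        (begin
          (βˢ d′ ∘ u) ∘ q  ≈⟨ pullʳ uq≈β ⟩
          βˢ d′ ∘ βˢ e     ≈⟨ β′βˢe≈βˢf ⟩
          βˢ f             ≈⟨ po.universal∘i₂ ⟨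
          w ∘ q            ∎)

  diagonal : ∀ {F₁ F₂ F₃ F₄} {e : FPCSquare F₁ F₂} {m : FPCSquare F₃ F₄}
    {f : FPCSquare F₁ F₃} {g : FPCSquare F₂ F₄} →
    AutoAugmented C M E e → Inert C M E m → g D.∘ e D.≈ m D.∘ f →
    Σ[ d ∈ FPCSquare F₂ F₃ ] ((d D.∘ e D.≈ f × m D.∘ d D.≈ g) ×
      (∀ (d′ : FPCSquare F₂ F₃) → d′ D.∘ e D.≈ f → m D.∘ d′ D.≈ g → d′ D.≈ d))
  diagonal {e = e} {m} {f} {g} (_ , _ , _ , po , _ , up≈a₂ , uq≈β , u∈E) (αm∈E , αm∈M) ge≈mf =
    d , (d∘e≈f , m∘d≈g) , d-unique
    where open Diagonal {e = e} {m} {f} {g} po up≈a₂ uq≈β u∈E (E∩M⇒iso αm∈E αm∈M) ge≈mf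

  autoAugmented-inert-structured : EMStructured D (AutoAugmented C M E) (Inert C M E)
  autoAugmented-inert-structured = record
    { E-isoˡ   = λ {_} {_} {_} {s} {i} → autoAugmented-isoˡ {s = s} {i = i}
    ; E-isoʳ   = λ {_} {_} {_} {i} {s} → autoAugmented-isoʳ {i = i} {s = s}
    ; M-isoˡ   = λ {_} {_} {_} {s} {i} → inert-isoˡ {s = s} {i = i}
    ; M-isoʳ   = λ {_} {_} {_} {i} {s} → inert-isoʳ {i = i} {s = s}
    ; factor   = factorise
    ; diagonal = λ {_} {_} {_} {_} {e} {m} {f} {g} → diagonal {e = e} {m = m} {f = f} {g = g}
    }

theorem6 : ∀ {o ℓ e p q} (C : Category o ℓ e) (E : MorClass C q) (M : MorClass C p)
    (SM : StableSystem C M) → EMStructured C E M →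
    (pbs : HasPullbacksAlong C M) → HasPushoutsAlong C M → HasFPCsAlong C M →
    StableUnderPushout C M → PushoutsStableUnderMPullbacks C M →
    EMStructured (FPCv C M SM pbs) (AutoAugmented C M E) (Inert C M E)
theorem6 C E M SM EM pbs pos fpcs _ _ =
  FPCvFactorisation.autoAugmented-inert-structured C E M SM EM pbs pos fpcs
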